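{- $$\overline{A\wr\!\wr B} \subseteq \overline{A}\wr\!\wr \overline{B}.$$
   Context: Permutations act on the right. For permutation groups $(A,V)$ and $(B,W)$, $A\wr\!\wr B$ denotes the wreath product in its product action: the permutation group on the set $V^W$ of functions from $W$ to $V$ consisting of all permutations $\phi$ given by $(f\phi)(w) = (f(w\beta))\alpha_w$ for all $f\in V^W$, $w\in W$, where $\beta\in B$ and $\alpha_w\in A$ for each $w\in W$. For a permutation group $A$ on $V$, $G^*(A)$ is the colored (complete) graph on $V$ in which the unordered pair $\{v,w\}$ gets color $i$ iff it lies in the $i$-th orbit of $A$ on unordered pairs of $V$, and $\overline{A} = Aut(G^*(A))$ denotes the closure of $A$. -}

module Defs where

open import Data.Nat using (ℕ)
open import Data.Fin using (Fin)
open import Data.Vec using (Vec; lookup)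
open import Data.Product using (Σ; _×_; ∃)
open import Data.Sum using (_⊎_)
open import Function using (flip)
open import Function.Bundles using (_↔_; Inverse)
open import Function.Construct.Identity using (↔-id)
open import Function.Construct.Symmetry using (↔-sym)
open import Function.Construct.Composition using (_↔-∘_)
open import Relation.Binary.PropositionalEquality using (_≡_; _≢_)

Perm : Set → Set
Perm X = X ↔ X

_^_ : {X : Set} → X → Perm X → X
v ^ σ = Inverse.to σ v

-- σ ∙ τ : first σ, then τ  (right action: v(στ) = (vσ)τ).
_∙_ : {X : Set} → Perm X → Perm X → Perm X
σ ∙ τ = τ ↔-∘ σ

PermSet : Set → Set₁
PermSet X = Perm X → Set

-- A is a permutation group: a subgroup of Sym(X).  Membership is
-- required to respect pointwise equality of permutations (permutations
-- are identified extensionally).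
record IsPermGroup {X : Set} (A : PermSet X) : Set where
  field
    respects : ∀ σ τ → (∀ x → x ^ σ ≡ x ^ τ) → A σ → A τ
    id∈      : A (↔-id X)
    ∙∈       : ∀ σ τ → A σ → A τ → A (σ ∙ τ)
    inv∈     : ∀ σ → A σ → A (↔-sym σ)

SamePair : {X : Set} → X → X → X → X → Set
SamePair v w v' w' = (v ≡ v' × w ≡ w') ⊎ (v ≡ w' × w ≡ v')

-- The edge {v,w} (v ≠ w) of the complete graph
-- on X gets as colour the A-orbit of the unordered pair {v,w}; σ is an
-- automorphism of the coloured graph G*(A) iff it maps every edge to an
-- edge of the same colour, i.e. {vσ,wσ} lies in the A-orbit of {v,w}.
closure : {X : Set} → PermSet X → PermSet X
closure {X} A σ =
  ∀ (v w : X) → v ≢ w →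
    Σ (Perm X) λ a → A a × SamePair (v ^ a) (w ^ a) (v ^ σ) (w ^ σ)

-- With V = Fin n, W = Fin m, the set
-- V^W of functions W → V is represented by Vec (Fin n) m (f(w) = lookup f w).
-- φ ∈ A ≀≀ B iff there are β ∈ B and α_w ∈ A (w ∈ W) with
--   (fφ)(w) = (f(wβ))α_w   for all f, w.
_≀≀_ : {n m : ℕ} → PermSet (Fin n) → PermSet (Fin m) → PermSet (Vec (Fin n) m)
_≀≀_ {n} {m} A B φ =
  Σ (Perm (Fin m)) λ β → B β ×
  Σ (Fin m → Perm (Fin n)) λ α → (∀ w → A (α w)) ×
    (∀ (f : Vec (Fin n) m) (w : Fin m) →
       lookup (f ^ φ) w ≡ lookup f (w ^ β) ^ α w)

-- An element ψ of A ≀≀ B with base permutation β maps two functions differing exactly on a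
-- set S of coordinates to two functions differing exactly on the preimage of S under β.  A
-- permutation φ in the closure maps each pair {f, g} onto its image under some such ψ, so φ
-- preserves Hamming distances 1 and 2.  For |V| ≥ 2 such a map sends all edges of the Hamming
-- graph in direction w to edges in a single direction γ w: triangles force this for parallel
-- edges, squares transport it to neighbouring vertices.  Hence (fφ)(γ w) depends only on f(w),
-- which puts φ in product action with base permutation γ⁻¹.  Comparing φ with the ψ's on pairs
-- differing in one coordinate puts the coordinate permutations into the closure of A; on pairs
-- differing in two coordinates it puts γ⁻¹ into the closure of B.
module Submission where

open import Defs
open import Data.Nat using (ℕ; zero; suc)
open import Data.Fin using (Fin; zero; suc; punchOut)
open import Data.Fin.Properties using (_≟_; any?; punchOut-injective; injective⇒≤)
open import Data.Vec using (Vec; lookup; replicate; []; _∷_; _[_]≔_)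
open import Data.Vec.Properties
  using (lookup∘update; lookup∘update′; []≔-idempotent; []≔-commutes; []≔-lookup; lookup-replicate)
open import Data.Product using (Σ; ∃; ∃₂; _×_; _,_; proj₁; proj₂)
open import Data.Sum using (_⊎_; inj₁; inj₂)
import Data.Sum as Sum
open import Data.Empty using (⊥-elim)
open import Function using (_∘_)
open import Function.Bundles using (Inverse; mk↔ₛ′)
open import Function.Definitions using (Injective)
open import Function.Construct.Identity using (↔-id)
open import Function.Construct.Symmetry using (↔-sym)
import Data.Nat.Properties as ℕ
open import Relation.Nullary using (¬_; yes; no)
open import Relation.Nullary.Decidable using (decidable-stable)
open import Relation.Binary.PropositionalEquality
  using (_≡_; _≢_; refl; sym; trans; cong; subst; module ≡-Reasoning)

private
  variable
    n m : ℕ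
    X : Set
    a b c d p q r s t u w : Fin m
    x y : Fin n
    f f′ g g′ h : Vec (Fin n) m
    P Q : Fin m → Set

module _ (σ : Perm X) where

  ^-injective : Injective _≡_ _≡_ (_^ σ)
  ^-injective {x} {y} e =
    trans (sym (Inverse.strictlyInverseʳ σ x))
          (trans (cong (Inverse.from σ) e) (Inverse.strictlyInverseʳ σ y))

  ^≡⇒≡from : ∀ {x y} → x ^ σ ≡ y → x ≡ Inverse.from σ y
  ^≡⇒≡from e = sym (Inverse.inverseʳ σ (sym e))

  ≡from⇒^≡ : ∀ {x y} → x ≡ Inverse.from σ y → x ^ σ ≡ y
  ≡from⇒^≡ = Inverse.inverseˡ σ

injective⇒surjective : {f : Fin n → Fin n} → Injective _≡_ _≡_ f →
                       ∀ y → ∃ λ x → f x ≡ y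
injective⇒surjective {zero}  _ ()
injective⇒surjective {suc n} {f} f-inj y with any? (λ x → f x ≟ y)
... | yes hit = hit
... | no miss = ⊥-elim (ℕ.1+n≰n (injective⇒≤ punch-inj))
  where
  y≢f : ∀ x → y ≢ f x
  y≢f x e = miss (x , sym e)

  punch : Fin (suc n) → Fin n
  punch x = punchOut (y≢f x)

  punch-inj : Injective _≡_ _≡_ punch
  punch-inj {x} {x′} e = f-inj (punchOut-injective (y≢f x) (y≢f x′) e)

injective⇒perm : (f : Fin n → Fin n) → Injective _≡_ _≡_ f → Perm (Fin n)
injective⇒perm f f-inj =
  mk↔ₛ′ f (proj₁ ∘ preimage) (proj₂ ∘ preimage) (f-inj ∘ proj₂ ∘ preimage ∘ f)
  where
  preimage : ∀ y → ∃ λ x → f x ≡ y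
  preimage = injective⇒surjective f-inj

samePair-subst : {a a′ b b′ c c′ d d′ : X} → a ≡ a′ → b ≡ b′ → c ≡ c′ → d ≡ d′ →
                 SamePair a b c d → SamePair a′ b′ c′ d′
samePair-subst refl refl refl refl same = same

samePair-lookup : ∀ t → SamePair f g f′ g′ →
                  SamePair (lookup f t) (lookup g t) (lookup f′ t) (lookup g′ t)
samePair-lookup t (inj₁ (refl , refl)) = inj₁ (refl , refl)
samePair-lookup t (inj₂ (refl , refl)) = inj₂ (refl , refl)

distinct∈pair⇒samePair : {a b p q : X} → a ≢ b →
                         a ≡ p ⊎ a ≡ q → b ≡ p ⊎ b ≡ q → SamePair a b p q
distinct∈pair⇒samePair a≢b (inj₁ a≡p) (inj₁ b≡p) = ⊥-elim (a≢b (trans a≡p (sym b≡p)))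
distinct∈pair⇒samePair a≢b (inj₁ a≡p) (inj₂ b≡q) = inj₁ (a≡p , b≡q)
distinct∈pair⇒samePair a≢b (inj₂ a≡q) (inj₁ b≡p) = inj₂ (a≡q , b≡p)
distinct∈pair⇒samePair a≢b (inj₂ a≡q) (inj₂ b≡q) = ⊥-elim (a≢b (trans a≡q (sym b≡q)))

update-induction : ∀ {A : Set} (R : Vec A m → Set) (f g : Vec A m) →
                   (∀ h i → R h → R (h [ i ]≔ lookup f i)) → R g → R f
update-induction R []      []      step Rg = Rg
update-induction R (x ∷ f) (y ∷ g) step Rg =
  update-induction (R ∘ (x ∷_)) f g (λ h i → step (x ∷ h) (suc i)) (step (y ∷ g) zero Rg)

record DifferExactlyOn (P : Fin m → Set) (f g : Vec (Fin n) m) : Set where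
  constructor differExactlyOn
  field
    differ⇒ : ∀ {t} → lookup f t ≢ lookup g t → P t
    ⇒differ : ∀ {t} → P t → lookup f t ≢ lookup g t

open DifferExactlyOn

Adjacent : Fin m → Vec (Fin n) m → Vec (Fin n) m → Set
Adjacent c = DifferExactlyOn (_≡ c)

AtDistanceTwo : Fin m → Fin m → Vec (Fin n) m → Vec (Fin n) m → Set
AtDistanceTwo a b f g = a ≢ b × DifferExactlyOn (λ t → t ≡ a ⊎ t ≡ b) f g

AgreeOff : Fin m → Vec (Fin n) m → Vec (Fin n) m → Set
AgreeOff c f g = ∀ t → t ≢ c → lookup f t ≡ lookup g t

differ-sym : DifferExactlyOn P f g → DifferExactlyOn P g f
differ-sym D = differExactlyOn (λ ne → differ⇒ D (ne ∘ sym)) (λ Pt → ⇒differ D Pt ∘ sym)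

differ-resp : (∀ {t} → P t → Q t) → (∀ {t} → Q t → P t) →
              DifferExactlyOn P f g → DifferExactlyOn Q f g
differ-resp P⇒Q Q⇒P D = differExactlyOn (P⇒Q ∘ differ⇒ D) (⇒differ D ∘ Q⇒P)

differ-samePair : SamePair f g f′ g′ → DifferExactlyOn P f g → DifferExactlyOn P f′ g′
differ-samePair (inj₁ (refl , refl)) D = D
differ-samePair (inj₂ (refl , refl)) D = differ-sym D

differ⇒≢ : DifferExactlyOn P f g → P t → f ≢ g
differ⇒≢ {t = t} D Pt f≡g = ⇒differ D Pt (cong (λ h → lookup h t) f≡g)

adjacent⇒agreeOff : Adjacent c f g → AgreeOff c f g
adjacent⇒agreeOff {f = f} {g} D t t≢c =
  decidable-stable (lookup f t ≟ lookup g t) (t≢c ∘ differ⇒ D)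

distanceTwo⇒¬agreeOff : AtDistanceTwo a b f g → ¬ AgreeOff c f g
distanceTwo⇒¬agreeOff {a = a} {b} {c = c} (a≢b , D) agree with a ≟ c
... | yes refl = ⇒differ D (inj₂ refl) (agree b (a≢b ∘ sym))
... | no a≢c   = ⇒differ D (inj₁ refl) (agree a a≢c)

adjacent-compose : u ≢ w → Adjacent u f g → Adjacent w g h → AtDistanceTwo u w f h
adjacent-compose {u = u} {w} {f = f} {g} {h} u≢w fg gh = u≢w , differExactlyOn off on
  where
  off : ∀ {t} → lookup f t ≢ lookup h t → t ≡ u ⊎ t ≡ w
  off {t} ne with t ≟ u | t ≟ w
  ... | yes t≡u | _       = inj₁ t≡u
  ... | no _    | yes t≡w = inj₂ t≡w
  ... | no t≢u  | no t≢w  =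
    ⊥-elim (ne (trans (adjacent⇒agreeOff fg t t≢u) (adjacent⇒agreeOff gh t t≢w)))

  on : ∀ {t} → t ≡ u ⊎ t ≡ w → lookup f t ≢ lookup h t
  on (inj₁ refl) e = ⇒differ fg refl (trans e (sym (adjacent⇒agreeOff gh u u≢w)))
  on (inj₂ refl) e = ⇒differ gh refl (trans (sym (adjacent⇒agreeOff fg w (u≢w ∘ sym))) e)

adjacent-triangle : Adjacent c g h → Adjacent d g f → Adjacent r h f → c ≡ d
adjacent-triangle {c = c} {h = h} {d = d} {f = f} gh gf hf with c ≟ d
... | yes c≡d = c≡d
... | no c≢d  = trans (differ⇒ hf differ-at-c) (sym (differ⇒ hf differ-at-d))
  where
  differ-at-c : lookup h c ≢ lookup f c
  differ-at-c e = ⇒differ gh refl (trans (adjacent⇒agreeOff gf c c≢d) (sym e))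
  differ-at-d : lookup h d ≢ lookup f d
  differ-at-d e = ⇒differ gf refl (trans (adjacent⇒agreeOff gh d (c≢d ∘ sym)) e)

adjacent-square-parallel : p ≢ q → Adjacent p f f′ → Adjacent q f g → Adjacent r g h →
                           Adjacent s f′ h → AtDistanceTwo a b f h → q ≡ s
adjacent-square-parallel {p = p} {q} {f = f} {f′} {g = g} {r = r} {h = h} p≢q ff′ fg gh f′h fh =
  differ⇒ f′h f′q≢hq
  where
  hq≢fq : lookup h q ≢ lookup f q
  hq≢fq hq≡fq = distanceTwo⇒¬agreeOff fh agree
    where
    q≡r : q ≡ r
    q≡r = differ⇒ gh (λ gq≡hq → ⇒differ fg refl (trans (sym hq≡fq) (sym gq≡hq)))

    agree : AgreeOff q f h
    agree t t≢q = trans (adjacent⇒agreeOff fg t t≢q)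
                        (adjacent⇒agreeOff gh t (λ t≡r → t≢q (trans t≡r (sym q≡r))))

  f′q≢hq : lookup f′ q ≢ lookup h q
  f′q≢hq e = hq≢fq (trans (sym e) (sym (adjacent⇒agreeOff ff′ q (p≢q ∘ sym))))

update-adjacent : x ≢ lookup f w → Adjacent w f (f [ w ]≔ x)
update-adjacent {x = x} {f = f} {w = w} x≢fw = differExactlyOn off on
  where
  off : ∀ {t} → lookup f t ≢ lookup (f [ w ]≔ x) t → t ≡ w
  off {t} ne with t ≟ w
  ... | yes t≡w = t≡w
  ... | no t≢w  = ⊥-elim (ne (sym (lookup∘update′ t≢w f x)))

  on : ∀ {t} → t ≡ w → lookup f t ≢ lookup (f [ w ]≔ x) t
  on refl e = x≢fw (trans (sym (lookup∘update w f x)) (sym e))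

updates-adjacent : x ≢ y → Adjacent w (f [ w ]≔ x) (f [ w ]≔ y)
updates-adjacent {x = x} {y} {w = w} {f = f} x≢y =
  subst (Adjacent w (f [ w ]≔ x)) ([]≔-idempotent f w)
        (update-adjacent (λ y≡ → x≢y (sym (trans y≡ (lookup∘update w f x)))))

ProductAction : Perm (Fin m) → (Fin m → Perm (Fin n)) → (Vec (Fin n) m → Vec (Fin n) m) → Set
ProductAction β α Φ = ∀ f w → lookup (Φ f) w ≡ lookup f (w ^ β) ^ α w

productAction-differ : ∀ {β α} {Φ : Vec (Fin n) m → Vec (Fin n) m} → ProductAction β α Φ →
                       DifferExactlyOn P f g → DifferExactlyOn (λ t → P (t ^ β)) (Φ f) (Φ g)
productAction-differ {f = f} {g} {β} {α} act D = differExactlyOn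
  (λ ne → differ⇒ D (λ e → ne (trans (act f _) (trans (cong (_^ α _) e) (sym (act g _))))))
  (λ Pt e → ⇒differ D Pt (^-injective (α _) (trans (sym (act f _)) (trans e (act g _)))))

module WreathClosure {A : PermSet (Fin n)} {B : PermSet (Fin m)} {φ : Perm (Vec (Fin n) m)}
                     (cl : closure (A ≀≀ B) φ) where

  closure-differ : f ≢ g → DifferExactlyOn P f g →
                   Σ (Perm (Fin m)) λ σ → B σ × DifferExactlyOn (λ t → P (t ^ σ)) (f ^ φ) (g ^ φ)
  closure-differ {f = f} {g} f≢g D with cl f g f≢g
  ... | _ , (σ , Bσ , α , _ , act) , same =
    σ , Bσ , differ-samePair same (productAction-differ {β = σ} {α} act D)

  closure-adjacent : Adjacent c f g → ∃ λ c′ → Adjacent c′ (f ^ φ) (g ^ φ)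
  closure-adjacent fg with closure-differ (differ⇒≢ fg refl) fg
  ... | σ , _ , D = Inverse.from σ _ , differ-resp (^≡⇒≡from σ) (≡from⇒^≡ σ) D

  closure-distanceTwo : AtDistanceTwo a b f g → ∃₂ λ a′ b′ → AtDistanceTwo a′ b′ (f ^ φ) (g ^ φ)
  closure-distanceTwo (a≢b , fg) with closure-differ (differ⇒≢ fg (inj₁ refl)) fg
  ... | σ , _ , D = Inverse.from σ _ , Inverse.from σ _ , a≢b ∘ ^-injective (↔-sym σ) ,
        differ-resp (Sum.map (^≡⇒≡from σ) (^≡⇒≡from σ)) (Sum.map (≡from⇒^≡ σ) (≡from⇒^≡ σ)) D

  module _ (β : Perm (Fin m)) (α : Fin m → Perm (Fin n)) (act : ProductAction β α (_^ φ)) where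

    closure-coordinates : ∀ t → closure A (α t)
    closure-coordinates t x y x≢y = fromWitness (cl f₀ g₀ (differ⇒≢ fg refl))
      where
      f₀ g₀ : Vec (Fin n) m
      f₀ = replicate m x
      g₀ = f₀ [ t ^ β ]≔ y

      fg : Adjacent (t ^ β) f₀ g₀
      fg = update-adjacent (λ e → x≢y (sym (trans e (lookup-replicate (t ^ β) x))))

      fromWitness : (Σ (Perm (Vec (Fin n) m)) λ ψ →
                       (A ≀≀ B) ψ × SamePair (f₀ ^ ψ) (g₀ ^ ψ) (f₀ ^ φ) (g₀ ^ φ)) →
                    Σ (Perm (Fin n)) λ a → A a × SamePair (x ^ a) (y ^ a) (x ^ α t) (y ^ α t)
      fromWitness (ψ , (β′ , _ , α′ , Aα′ , act′) , same) =
        α′ t , Aα′ t ,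
        samePair-subst (trans (act′ f₀ t) (cong (_^ α′ t) (lookup-replicate (t ^ β′) x)))
                       (trans (act′ g₀ t) (cong (_^ α′ t) (trans (cong (lookup g₀) tβ′≡tβ) g-at-tβ)))
                       (trans (act f₀ t) (cong (_^ α t) (lookup-replicate (t ^ β) x)))
                       (trans (act g₀ t) (cong (_^ α t) g-at-tβ))
                       (samePair-lookup t same)
        where
        g-at-tβ : lookup g₀ (t ^ β) ≡ y
        g-at-tβ = lookup∘update (t ^ β) f₀ y

        tβ′≡tβ : t ^ β′ ≡ t ^ β
        tβ′≡tβ = differ⇒ (differ-samePair same (productAction-differ {β = β′} {α′} {_^ ψ} act′ fg))
                         (⇒differ (productAction-differ {β = β} {α} {_^ φ} act fg) refl)

    closure-base : {x y : Fin n} → x ≢ y → closure B β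
    closure-base {x} {y} x≢y u v u≢v =
      fromWitness (closure-differ (differ⇒≢ (proj₂ fg) (inj₁ refl)) (proj₂ fg))
      where
      uβ vβ : Fin m
      uβ = u ^ β
      vβ = v ^ β

      f₀ g₀ : Vec (Fin n) m
      f₀ = replicate m x
      g₀ = (f₀ [ uβ ]≔ y) [ vβ ]≔ y

      uβ≢vβ : uβ ≢ vβ
      uβ≢vβ = u≢v ∘ ^-injective β

      fg : AtDistanceTwo uβ vβ f₀ g₀
      fg = adjacent-compose uβ≢vβ
        (update-adjacent (λ e → x≢y (sym (trans e (lookup-replicate uβ x)))))
        (update-adjacent (λ e → x≢y (sym (trans e (trans (lookup∘update′ (uβ≢vβ ∘ sym) f₀ y)
                                                          (lookup-replicate vβ x))))))

      φ-differ : DifferExactlyOn (λ t → t ^ β ≡ uβ ⊎ t ^ β ≡ vβ) (f₀ ^ φ) (g₀ ^ φ)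
      φ-differ = productAction-differ {β = β} {α} {_^ φ} act (proj₂ fg)

      fromWitness : (Σ (Perm (Fin m)) λ σ →
                       B σ × DifferExactlyOn (λ t → t ^ σ ≡ uβ ⊎ t ^ σ ≡ vβ) (f₀ ^ φ) (g₀ ^ φ)) →
                    Σ (Perm (Fin m)) λ b → B b × SamePair (u ^ b) (v ^ b) uβ vβ
      fromWitness (σ , Bσ , σ-differ) =
        σ , Bσ , distinct∈pair⇒samePair (u≢v ∘ ^-injective σ)
                   (differ⇒ σ-differ (⇒differ φ-differ (inj₁ refl)))
                   (differ⇒ σ-differ (⇒differ φ-differ (inj₂ refl)))

module HammingMap
  {n m : ℕ} (Φ : Vec (Fin n) m → Vec (Fin n) m)
  (adjacent-image : ∀ {c} {f g : Vec (Fin n) m} → Adjacent c f g → ∃ λ c′ → Adjacent c′ (Φ f) (Φ g))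
  (distanceTwo-image : ∀ {a b} {f g : Vec (Fin n) m} → AtDistanceTwo a b f g →
                       ∃₂ λ a′ b′ → AtDistanceTwo a′ b′ (Φ f) (Φ g))
  {x₀ x₁ : Fin n} (x₁≢x₀ : x₁ ≢ x₀)
  where

  origin : Vec (Fin n) m
  origin = replicate m x₀

  origin-adjacent : ∀ w → Adjacent w origin (origin [ w ]≔ x₁)
  origin-adjacent w = update-adjacent (λ e → x₁≢x₀ (trans e (lookup-replicate w x₀)))

  γ : Fin m → Fin m
  γ w = proj₁ (adjacent-image (origin-adjacent w))

  γ-adjacent : ∀ w → Adjacent (γ w) (Φ origin) (Φ (origin [ w ]≔ x₁))
  γ-adjacent w = proj₂ (adjacent-image (origin-adjacent w))

  γ-injective : Injective _≡_ _≡_ γ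
  γ-injective {u} {w} γu≡γw with u ≟ w
  ... | yes u≡w = u≡w
  ... | no u≢w  = ⊥-elim (distanceTwo⇒¬agreeOff (proj₂ (proj₂ image-distanceTwo)) agree)
    where
    image-distanceTwo : ∃₂ λ a b → AtDistanceTwo a b (Φ (origin [ u ]≔ x₁)) (Φ (origin [ w ]≔ x₁))
    image-distanceTwo =
      distanceTwo-image (adjacent-compose u≢w (differ-sym (origin-adjacent u)) (origin-adjacent w))

    agree : AgreeOff (γ u) (Φ (origin [ u ]≔ x₁)) (Φ (origin [ w ]≔ x₁))
    agree t t≢γu = trans (sym (adjacent⇒agreeOff (γ-adjacent u) t t≢γu))
                         (adjacent⇒agreeOff (γ-adjacent w) t (subst (t ≢_) γu≡γw t≢γu))

  MapsDirections : Vec (Fin n) m → Set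
  MapsDirections f = ∀ w x → x ≢ lookup f w → Adjacent (γ w) (Φ f) (Φ (f [ w ]≔ x))

  image-triangle : ∀ {c d e} {g h₁ h₂ : Vec (Fin n) m} →
                   Adjacent c (Φ g) (Φ h₁) → Adjacent d h₁ h₂ → Adjacent e g h₂ →
                   Adjacent c (Φ g) (Φ h₂)
  image-triangle gh₁ h₁h₂ gh₂ with adjacent-image gh₂ | adjacent-image h₁h₂
  ... | _ , Φgh₂ | _ , Φh₁h₂ =
    subst (λ c → Adjacent c _ _) (sym (adjacent-triangle gh₁ Φgh₂ Φh₁h₂)) Φgh₂

  mapsDirections-origin : MapsDirections origin
  mapsDirections-origin w x x≢x₀ with x ≟ x₁
  ... | yes refl = γ-adjacent w
  ... | no x≢x₁  = image-triangle (γ-adjacent w) (updates-adjacent (x≢x₁ ∘ sym)) (update-adjacent x≢x₀)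

  module _ {f : Vec (Fin n) m} (dir : MapsDirections f) {u y} (y≢fu : y ≢ lookup f u) where

    mapsDirections-update-same : ∀ x → x ≢ y →
      Adjacent (γ u) (Φ (f [ u ]≔ y)) (Φ ((f [ u ]≔ y) [ u ]≔ x))
    mapsDirections-update-same x x≢y rewrite []≔-idempotent {x = y} {y = x} f u with x ≟ lookup f u
    ... | yes refl = subst (λ h → Adjacent (γ u) (Φ (f [ u ]≔ y)) (Φ h)) (sym ([]≔-lookup f u))
                           (differ-sym (dir u y y≢fu))
    ... | no x≢fu  = image-triangle (differ-sym (dir u y y≢fu)) (update-adjacent x≢fu)
                                    (updates-adjacent (x≢y ∘ sym))

    mapsDirections-update-other : ∀ {w x} → u ≢ w → x ≢ lookup f w →
      Adjacent (γ w) (Φ (f [ u ]≔ y)) (Φ ((f [ u ]≔ y) [ w ]≔ x))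
    mapsDirections-update-other {w} {x} u≢w x≢fw =
      subst (λ c → Adjacent c _ _)
            (sym (adjacent-square-parallel (u≢w ∘ γ-injective) (dir u y y≢fu) (dir w x x≢fw)
                                  (proj₂ (adjacent-image gh)) (proj₂ (adjacent-image f′h))
                                  (proj₂ (proj₂ (distanceTwo-image fh)))))
            (proj₂ (adjacent-image f′h))
      where
      f′h : Adjacent w (f [ u ]≔ y) ((f [ u ]≔ y) [ w ]≔ x)
      f′h = update-adjacent (λ e → x≢fw (trans e (lookup∘update′ (u≢w ∘ sym) f y)))

      gh : Adjacent u (f [ w ]≔ x) ((f [ u ]≔ y) [ w ]≔ x)
      gh = subst (Adjacent u (f [ w ]≔ x)) (sym ([]≔-commutes f u w u≢w))
                 (update-adjacent (λ e → y≢fu (trans e (lookup∘update′ u≢w f x))))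

      fh : AtDistanceTwo u w f ((f [ u ]≔ y) [ w ]≔ x)
      fh = adjacent-compose u≢w (update-adjacent y≢fu) f′h

  mapsDirections-update : ∀ {f} u y → MapsDirections f → MapsDirections (f [ u ]≔ y)
  mapsDirections-update {f} u y dir with y ≟ lookup f u
  ... | yes refl = subst MapsDirections (sym ([]≔-lookup f u)) dir
  ... | no y≢fu  = dir′
    where
    dir′ : MapsDirections (f [ u ]≔ y)
    dir′ w x x≢ with w ≟ u
    ... | yes refl = mapsDirections-update-same dir y≢fu x
                       (λ x≡y → x≢ (trans x≡y (sym (lookup∘update w f y))))
    ... | no w≢u   = mapsDirections-update-other dir y≢fu (w≢u ∘ sym)
                       (λ e → x≢ (trans e (sym (lookup∘update′ w≢u f y))))

  mapsDirections : ∀ f → MapsDirections f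
  mapsDirections f =
    update-induction MapsDirections f origin (λ h i → mapsDirections-update i (lookup f i))
                     mapsDirections-origin

  update-preserves-γ : ∀ {i w} (h : Vec (Fin n) m) x → i ≢ w →
                       lookup (Φ (h [ i ]≔ x)) (γ w) ≡ lookup (Φ h) (γ w)
  update-preserves-γ {i} {w} h x i≢w with x ≟ lookup h i
  ... | yes refl = cong (λ h′ → lookup (Φ h′) (γ w)) ([]≔-lookup h i)
  ... | no x≢hi  = sym (adjacent⇒agreeOff (mapsDirections h i x x≢hi) (γ w) (i≢w ∘ sym ∘ γ-injective))

  γ-coordinate-determined : ∀ {f g} w → lookup f w ≡ lookup g w →
                            lookup (Φ f) (γ w) ≡ lookup (Φ g) (γ w)
  γ-coordinate-determined {f} {g} w fw≡gw = proj₂ (update-induction R f g step (sym fw≡gw , refl))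
    where
    R : Vec (Fin n) m → Set
    R h = lookup h w ≡ lookup f w × lookup (Φ h) (γ w) ≡ lookup (Φ g) (γ w)

    step : ∀ h i → R h → R (h [ i ]≔ lookup f i)
    step h i (hw≡fw , Φhγw≡Φgγw) with i ≟ w
    ... | yes refl = subst R (trans (sym ([]≔-lookup h i)) (cong (h [ i ]≔_) hw≡fw))
                             (hw≡fw , Φhγw≡Φgγw)
    ... | no i≢w   = trans (lookup∘update′ (i≢w ∘ sym) h _) hw≡fw ,
                     trans (update-preserves-γ h _ i≢w) Φhγw≡Φgγw

  α : Fin m → Fin n → Fin n
  α w x = lookup (Φ (origin [ w ]≔ x)) (γ w)

  α-injective : ∀ w → Injective _≡_ _≡_ (α w)
  α-injective w {x} {y} αx≡αy with x ≟ y
  ... | yes x≡y = x≡y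
  ... | no x≢y  = ⊥-elim (⇒differ image-adjacent refl αx≡αy)
    where
    image-adjacent : Adjacent (γ w) (Φ (origin [ w ]≔ x)) (Φ (origin [ w ]≔ y))
    image-adjacent =
      subst (λ h → Adjacent (γ w) (Φ (origin [ w ]≔ x)) (Φ h)) ([]≔-idempotent origin w)
      (mapsDirections (origin [ w ]≔ x) w y (λ e → x≢y (sym (trans e (lookup∘update w origin x)))))

  Γ : Perm (Fin m)
  Γ = injective⇒perm γ γ-injective

  β : Perm (Fin m)
  β = ↔-sym Γ

  α-perm : Fin m → Perm (Fin n)
  α-perm t = injective⇒perm (α (t ^ β)) (α-injective (t ^ β))

  productAction : ProductAction β α-perm Φ
  productAction f t = begin
    lookup (Φ f) t
      ≡⟨ cong (lookup (Φ f)) (sym (Inverse.strictlyInverseˡ Γ t)) ⟩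
    lookup (Φ f) (γ v)
      ≡⟨ γ-coordinate-determined v (sym (lookup∘update v origin (lookup f v))) ⟩
    lookup (Φ (origin [ v ]≔ lookup f v)) (γ v) ∎
    where
    open ≡-Reasoning
    v : Fin m
    v = t ^ β

id∈closure : {A : PermSet X} → IsPermGroup A → closure A (↔-id X)
id∈closure A-group _ _ _ = ↔-id _ , IsPermGroup.id∈ A-group , inj₁ (refl , refl)

subsingleton⇒∈closure≀≀closure : {A : PermSet (Fin n)} {B : PermSet (Fin m)} →
  IsPermGroup A → IsPermGroup B → (∀ (x y : Fin n) → x ≡ y) →
  (φ : Perm (Vec (Fin n) m)) → (closure A ≀≀ closure B) φ
subsingleton⇒∈closure≀≀closure A-group B-group irrelevant φ =
  ↔-id _ , id∈closure B-group , (λ _ → ↔-id _) , (λ _ → id∈closure A-group) , λ _ _ → irrelevant _ _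

lemma3p2 : (n m : ℕ) (A : PermSet (Fin n)) (B : PermSet (Fin m)) →
    IsPermGroup A → IsPermGroup B →
    (φ : Perm (Vec (Fin n) m)) →
    closure (A ≀≀ B) φ → (closure A ≀≀ closure B) φ
-- The group axioms only serve to put the identity into the closures when |V| ≤ 1.
lemma3p2 zero          m A B A-group B-group φ _ =
  subsingleton⇒∈closure≀≀closure A-group B-group (λ ()) φ
lemma3p2 (suc zero)    m A B A-group B-group φ _ =
  subsingleton⇒∈closure≀≀closure A-group B-group (λ { zero zero → refl }) φ
lemma3p2 (suc (suc k)) m A B _ _ φ cl =
  β , closure-base β α-perm productAction 0≢1 ,
  α-perm , closure-coordinates β α-perm productAction , productAction
  where
  0≢1 : zero ≢ suc zero
  0≢1 ()

  open WreathClosure {A = A} {B} {φ} cl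
  open HammingMap (_^ φ) closure-adjacent closure-distanceTwo (0≢1 ∘ sym)
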